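{- If a bidimensional infinite word $w\colon\mathbb{N}^2\to A$ is URD, then all its rows $(w(i,j))_{i\in\mathbb{N}}$ ($j\in\mathbb{N}$) and all its columns $(w(i,j))_{j\in\mathbb{N}}$ ($i\in\mathbb{N}$) are uniformly recurrent one-dimensional words. The converse does not hold: there exists a bidimensional word all of whose rows and columns are uniformly recurrent but which is not URD.
   Context: $\mathbb{N}=\{0,1,\ldots\}$, $A$ finite. A one-dimensional word is uniformly recurrent if for each prefix $p$ there is $b$ with every length-$b$ factor containing $p$. A direction is $\mathbf{q}\in\mathbb{N}^2$ with coprime nonnegative entries. For $\mathbf{s}=(s_1,s_2)$, $w_{\mathbf{q},\mathbf{s}}$ is the one-dimensional word whose $\ell$-th letter is the block $\mathbf{i}\mapsto w(\mathbf{i}+\ell\mathbf{q})$, $\mathbf{i}\in\{0,\ldots,s_1-1\}\times\{0,\ldots,s_2-1\}$. $w$ is URD if for all sizes $\mathbf{s}$ and all directions $\mathbf{q}$ there is $b$ such that every length-$b$ factor of $w_{\mathbf{q},\mathbf{s}}$ contains the letter $w_{\mathbf{q},\mathbf{s}}(0)$. -}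

module Defs where

open import Data.Nat using (ℕ; _+_; _*_; _≤_; _<_)
open import Data.Nat.Coprimality using (Coprime)
open import Data.Product using (Σ; _×_; ∃-syntax)
open import Relation.Binary.PropositionalEquality using (_≡_)

Word : Set → Set
Word A = ℕ → A

Word2 : Set → Set
Word2 A = ℕ → ℕ → A

FactorContainsPrefix : {A : Set} → Word A → (m b n : ℕ) → Set
FactorContainsPrefix u m b n =
  ∃[ t ] (m ≤ t × t + n ≤ m + b × ((i : ℕ) → i < n → u (t + i) ≡ u i))

UniformlyRecurrent : {A : Set} → Word A → Set
UniformlyRecurrent u =
  (n : ℕ) → ∃[ b ] ((m : ℕ) → FactorContainsPrefix u m b n)

Direction : ℕ → ℕ → Set
Direction q1 q2 = Coprime q1 q2

-- The ℓ-th letter of w_{q,s} equals the 0-th letter (the block at the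
-- origin), equality of blocks being pointwise on {0..s1-1}×{0..s2-1}.
BlockAtEqualsOrigin : {A : Set} → Word2 A → (q1 q2 s1 s2 ℓ : ℕ) → Set
BlockAtEqualsOrigin w q1 q2 s1 s2 ℓ =
  (i₁ i₂ : ℕ) → i₁ < s1 → i₂ < s2 →
    w (i₁ + ℓ * q1) (i₂ + ℓ * q2) ≡ w i₁ i₂

URD : {A : Set} → Word2 A → Set
URD w =
  (s1 s2 : ℕ) → (q1 q2 : ℕ) → Direction q1 q2 →
    ∃[ b ] ((m : ℕ) → ∃[ ℓ ] (m ≤ ℓ × ℓ < m + b × BlockAtEqualsOrigin w q1 q2 s1 s2 ℓ))

row : {A : Set} → Word2 A → ℕ → Word A
row w j = λ i → w i j

column : {A : Set} → Word2 A → ℕ → Word A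
column w i = λ j → w i j

-- Rows: an occurrence in direction (1, 0) of the (n × (j + 1))-block at the origin contains an
-- occurrence of the length-n prefix of row j. Columns are the rows of the transposed word, which
-- is again URD.
--
-- Converse: the period-doubling word d(n) = [ν₂(n) is odd] (n ≥ 1) is a Toeplitz word with a hole
-- at 0: its prefix d(1) … d(2ᴹ − 1) recurs at every odd multiple of 2ᴹ, where d takes the value
-- [M is odd]. Hence filling the hole with either letter gives a uniformly recurrent word. Filling
-- it in row j with [j is odd] yields a word whose column 0 is 0101… and whose other columns are
-- constant, so the vertical block (0, 1) at the origin never reappears in direction (1, 0).
module Submission where

open import Defs
open import Data.Nat using (ℕ)
open import Data.Fin using (Fin)
open import Data.Product using (_×_; ∃-syntax)
open import Relation.Nullary using (¬_)

open import Data.Bool using (Bool; true; false; not) renaming (_≟_ to _≟ᵇ_)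
open import Data.Bool.Properties using (not-involutive; ¬-not)
import Data.Fin as Fin
open import Data.Nat using (zero; suc; _+_; _*_; _^_; _≤_; _<_; s≤s; z<s; s<s; NonZero)
open import Data.Nat.Binary using (ℕᵇ; 2[1+_]; 1+[2_]; toℕ; fromℕ) renaming (zero to 0ᵇ)
open import Data.Nat.Binary.Properties using (toℕ-fromℕ; fromℕ-toℕ)
open import Data.Nat.Coprimality using (1-coprimeTo) renaming (sym to Coprime-sym)
open import Data.Nat.DivMod using (_/_; _%_; m≡m%n+[m/n]*n; m%n<n; m/n*n≤m)
open import Data.Nat.Properties
open import Data.Nat.Tactic.RingSolver using (solve-∀)
open import Data.Product using (_,_; proj₂)
open import Function using (_∘_)
open import Relation.Nullary using (yes; no)
open import Relation.Binary.PropositionalEquality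

private
  variable
    A B : Set

PrefixOccursAt : Word A → (n t : ℕ) → Set
PrefixOccursAt u n t = (i : ℕ) → i < n → u (t + i) ≡ u i

PrefixOccursSyndetically : Word A → ℕ → Set
PrefixOccursSyndetically u n =
  ∃[ g ] ((m : ℕ) → ∃[ t ] (m ≤ t × t ≤ m + g × PrefixOccursAt u n t))

syndetic⇒uniformlyRecurrent : {u : Word A} →
  ((n : ℕ) → PrefixOccursSyndetically u n) → UniformlyRecurrent u
syndetic⇒uniformlyRecurrent occurs n =
  let (g , occurs-after) = occurs n in
  g + n , λ m → let (t , m≤t , t≤m+g , occ) = occurs-after m in
    t , m≤t , subst (t + n ≤_) (+-assoc m g n) (+-monoˡ-≤ n t≤m+g) , occ

progression⇒syndetic : {u : Word A} {n : ℕ} (r p : ℕ) .{{_ : NonZero p}} →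
  ((q : ℕ) → PrefixOccursAt u n (r + q * p)) → PrefixOccursSyndetically u n
progression⇒syndetic r p occurs =
  r + p , λ m → r + suc (m / p) * p , lower m , upper m , occurs (suc (m / p))
  where
  open ≤-Reasoning
  lower : ∀ m → m ≤ r + suc (m / p) * p
  lower m = begin
    m                   ≡⟨ m≡m%n+[m/n]*n m p ⟩
    m % p + m / p * p   ≤⟨ +-monoˡ-≤ (m / p * p) (<⇒≤ (m%n<n m p)) ⟩
    suc (m / p) * p     ≤⟨ m≤n+m _ r ⟩
    r + suc (m / p) * p ∎
  upper : ∀ m → r + suc (m / p) * p ≤ m + (r + p)
  upper m = begin
    r + (p + m / p * p) ≤⟨ +-monoʳ-≤ r (+-monoʳ-≤ p (m/n*n≤m m p)) ⟩
    r + (p + m)         ≡⟨ sym (+-assoc r p m) ⟩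
    r + p + m           ≡⟨ +-comm (r + p) m ⟩
    m + (r + p)         ∎

uniformlyRecurrent-map : (f : A → B) {u : Word A} →
  UniformlyRecurrent u → UniformlyRecurrent (f ∘ u)
uniformlyRecurrent-map f ur n =
  let (b , contains) = ur n in
  b , λ m → let (t , m≤t , t+n≤m+b , occ) = contains m in
    t , m≤t , t+n≤m+b , λ i i<n → cong f (occ i i<n)

constant-uniformlyRecurrent : (c : A) → UniformlyRecurrent {A} (λ _ → c)
constant-uniformlyRecurrent c n = n , λ m → m , ≤-refl , ≤-refl , λ _ _ → refl

transpose : Word2 A → Word2 A
transpose w i j = w j i

URD-transpose : {w : Word2 A} → URD w → URD (transpose w)
URD-transpose urd s1 s2 q1 q2 q-coprime =
  let (b , occurs) = urd s2 s1 q2 q1 (Coprime-sym q-coprime) in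
  b , λ m → let (ℓ , m≤ℓ , ℓ<m+b , block) = occurs m in
    ℓ , m≤ℓ , ℓ<m+b , λ i₁ i₂ i₁<s1 i₂<s2 → block i₂ i₁ i₂<s2 i₁<s1

horizontalBlock : {w : Word2 A} {s1 s2 ℓ i₁ i₂ : ℕ} →
  BlockAtEqualsOrigin w 1 0 s1 s2 ℓ → i₁ < s1 → i₂ < s2 → w (ℓ + i₁) i₂ ≡ w i₁ i₂
horizontalBlock {w = w} {ℓ = ℓ} {i₁} {i₂} block i₁<s1 i₂<s2 = begin
  w (ℓ + i₁) i₂              ≡⟨ cong₂ w (+-comm ℓ i₁) (sym (+-identityʳ i₂)) ⟩
  w (i₁ + ℓ) (i₂ + 0)         ≡⟨ cong₂ w (cong (i₁ +_) (sym (*-identityʳ ℓ))) (cong (i₂ +_) (sym (*-zeroʳ ℓ))) ⟩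
  w (i₁ + ℓ * 1) (i₂ + ℓ * 0) ≡⟨ block i₁ i₂ i₁<s1 i₂<s2 ⟩
  w i₁ i₂                     ∎
  where open ≡-Reasoning

URD⇒rows-uniformlyRecurrent : {w : Word2 A} → URD w → (j : ℕ) → UniformlyRecurrent (row w j)
URD⇒rows-uniformlyRecurrent urd j = syndetic⇒uniformlyRecurrent λ n →
  let (b , occurs) = urd n (suc j) 1 0 (1-coprimeTo 0) in
  b , λ m → let (ℓ , m≤ℓ , ℓ<m+b , block) = occurs m in
    ℓ , m≤ℓ , <⇒≤ ℓ<m+b , λ i i<n → horizontalBlock block i<n (n<1+n j)

URD⇒columns-uniformlyRecurrent : {w : Word2 A} → URD w → (i : ℕ) → UniformlyRecurrent (column w i)
URD⇒columns-uniformlyRecurrent urd = URD⇒rows-uniformlyRecurrent (URD-transpose urd)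

isOdd : Word Bool
isOdd zero    = false
isOdd (suc n) = not (isOdd n)

isOdd-periodic : ∀ q i → isOdd (q * 2 + i) ≡ isOdd i
isOdd-periodic zero    i = refl
isOdd-periodic (suc q) i = trans (not-involutive _) (isOdd-periodic q i)

isOdd-uniformlyRecurrent : UniformlyRecurrent isOdd
isOdd-uniformlyRecurrent = syndetic⇒uniformlyRecurrent λ n →
  progression⇒syndetic 0 2 (λ q i _ → isOdd-periodic q i)

isOdd-hits : ∀ a n → ∃[ M ] (n ≤ M × isOdd M ≡ a)
isOdd-hits a n with isOdd n ≟ᵇ a
... | yes odd≡a = n , ≤-refl , odd≡a
... | no  odd≢a = suc n , n≤1+n n , sym (¬-not (odd≢a ∘ sym))

n<2^n : ∀ n → n < 2 ^ n
n<2^n zero    = z<s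
n<2^n (suc n) = +-mono-≤ (m^n>0 2 n) (≤-trans (n<2^n n) (m≤m+n (2 ^ n) 0))

data Halving : ℕ → Set where
  even : ∀ r → Halving (r * 2)
  odd  : ∀ r → Halving (suc (r * 2))

halving : ∀ n → Halving n
halving zero = even 0
halving (suc zero) = odd 0
halving (suc (suc n)) with halving n
... | even r = even (suc r)
... | odd  r = odd (suc r)

-- periodDoublingᵇ x is the letter at position toℕ x + 1; the shift makes the recursion structural.
periodDoublingᵇ : ℕᵇ → Bool
periodDoublingᵇ 0ᵇ       = false
periodDoublingᵇ 2[1+ x ] = false
periodDoublingᵇ 1+[2 x ] = not (periodDoublingᵇ x)

-- The letter at 0 is arbitrary: it is the hole.
periodDoubling : Word Bool
periodDoubling zero    = false
periodDoubling (suc n) = periodDoublingᵇ (fromℕ n)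

periodDoubling-suc-toℕ : ∀ x → periodDoubling (suc (toℕ x)) ≡ periodDoublingᵇ x
periodDoubling-suc-toℕ x = cong periodDoublingᵇ (fromℕ-toℕ x)

periodDoubling-odd : ∀ n → periodDoubling (suc (n * 2)) ≡ false
periodDoubling-odd zero    = refl
periodDoubling-odd (suc n) = begin
  periodDoubling (suc (suc n * 2))                 ≡⟨ cong (periodDoubling ∘ suc) (*-comm (suc n) 2) ⟩
  periodDoubling (suc (2 * suc n))                 ≡⟨ cong (λ k → periodDoubling (suc (2 * suc k))) (toℕ-fromℕ n) ⟨
  periodDoubling (suc (toℕ 2[1+ fromℕ n ]))        ≡⟨ periodDoubling-suc-toℕ 2[1+ fromℕ n ] ⟩
  false                                            ∎
  where open ≡-Reasoning

periodDoubling-double : ∀ {n} → 0 < n → periodDoubling (n * 2) ≡ not (periodDoubling n)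
periodDoubling-double {suc n} _ = begin
  periodDoubling (suc (suc (n * 2)))               ≡⟨ cong (periodDoubling ∘ suc ∘ suc) (*-comm n 2) ⟩
  periodDoubling (suc (suc (2 * n)))               ≡⟨ cong (λ k → periodDoubling (suc (suc (2 * k)))) (toℕ-fromℕ n) ⟨
  periodDoubling (suc (toℕ 1+[2 fromℕ n ]))        ≡⟨ periodDoubling-suc-toℕ 1+[2 fromℕ n ] ⟩
  not (periodDoubling (suc n))                     ∎
  where open ≡-Reasoning

periodDoubling-shift : ∀ N k i → 0 < i → i < 2 ^ N →
  periodDoubling (k * 2 ^ N + i) ≡ periodDoubling i
periodDoubling-shift zero    k zero    () _
periodDoubling-shift zero    k (suc i) _  (s≤s ())
periodDoubling-shift (suc N) k i 0<i i<2^N+1 with halving i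
... | even r = begin
  periodDoubling (k * 2 ^ suc N + r * 2)  ≡⟨ cong periodDoubling (regroup k (2 ^ N) r) ⟩
  periodDoubling ((k * 2 ^ N + r) * 2)    ≡⟨ periodDoubling-double (≤-trans 0<r (m≤n+m r (k * 2 ^ N))) ⟩
  not (periodDoubling (k * 2 ^ N + r))    ≡⟨ cong not (periodDoubling-shift N k r 0<r r<2^N) ⟩
  not (periodDoubling r)                  ≡⟨ periodDoubling-double 0<r ⟨
  periodDoubling (r * 2)                  ∎
  where
  open ≡-Reasoning
  regroup : ∀ k a r → k * (2 * a) + r * 2 ≡ (k * a + r) * 2
  regroup = solve-∀
  0<r : 0 < r
  0<r = *-cancelʳ-< 2 0 r 0<i
  r<2^N : r < 2 ^ N
  r<2^N = *-cancelʳ-< 2 r (2 ^ N) (subst (r * 2 <_) (*-comm 2 (2 ^ N)) i<2^N+1)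
... | odd r = begin
  periodDoubling (k * 2 ^ suc N + suc (r * 2))  ≡⟨ cong periodDoubling (regroup k (2 ^ N) r) ⟩
  periodDoubling (suc ((k * 2 ^ N + r) * 2))    ≡⟨ periodDoubling-odd (k * 2 ^ N + r) ⟩
  false                                         ≡⟨ periodDoubling-odd r ⟨
  periodDoubling (suc (r * 2))                  ∎
  where
  open ≡-Reasoning
  regroup : ∀ k a r → k * (2 * a) + suc (r * 2) ≡ suc ((k * a + r) * 2)
  regroup = solve-∀

periodDoubling-oddMultiple : ∀ M q → periodDoubling (suc (q * 2) * 2 ^ M) ≡ isOdd M
periodDoubling-oddMultiple zero    q =
  trans (cong periodDoubling (*-identityʳ (suc (q * 2)))) (periodDoubling-odd q)
periodDoubling-oddMultiple (suc M) q = begin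
  periodDoubling (suc (q * 2) * (2 * 2 ^ M))   ≡⟨ cong periodDoubling (regroup (suc (q * 2)) (2 ^ M)) ⟩
  periodDoubling (suc (q * 2) * 2 ^ M * 2)     ≡⟨ periodDoubling-double (≤-trans (m^n>0 2 M) (m≤m+n (2 ^ M) _)) ⟩
  not (periodDoubling (suc (q * 2) * 2 ^ M))   ≡⟨ cong not (periodDoubling-oddMultiple M q) ⟩
  not (isOdd M)                                ∎
  where
  open ≡-Reasoning
  regroup : ∀ a b → a * (2 * b) ≡ a * b * 2
  regroup = solve-∀

setHead : A → Word A → Word A
setHead a u zero    = a
setHead a u (suc i) = u (suc i)

setHead-positive : ∀ a (u : Word A) {i} → 0 < i → setHead a u i ≡ u i
setHead-positive a u {suc i} _ = refl

periodDoubling-prefixAtOddMultiple : ∀ M q i → i < 2 ^ M →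
  periodDoubling (suc (q * 2) * 2 ^ M + i) ≡ setHead (isOdd M) periodDoubling i
periodDoubling-prefixAtOddMultiple M q zero    _      =
  trans (cong periodDoubling (+-identityʳ (suc (q * 2) * 2 ^ M))) (periodDoubling-oddMultiple M q)
periodDoubling-prefixAtOddMultiple M q (suc i) i<2^M =
  periodDoubling-shift M (suc (q * 2)) (suc i) z<s i<2^M

setHead-periodDoubling-syndetic : ∀ a n → PrefixOccursSyndetically (setHead a periodDoubling) n
setHead-periodDoubling-syndetic a n with isOdd-hits a n
... | M , n≤M , refl = progression⇒syndetic (2 ^ M) (2 ^ suc M) {{m^n≢0 2 (suc M)}} λ q i i<n →
    let 0<t+i = ≤-trans (m^n>0 2 M) (≤-trans (m≤m+n (2 ^ M) _) (m≤m+n _ i))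
    in begin
    setHead (isOdd M) periodDoubling (2 ^ M + q * 2 ^ suc M + i) ≡⟨ setHead-positive _ periodDoubling 0<t+i ⟩
    periodDoubling (2 ^ M + q * (2 * 2 ^ M) + i)                 ≡⟨ cong (λ t → periodDoubling (2 ^ M + t + i)) (*-assoc q 2 (2 ^ M)) ⟨
    periodDoubling (suc (q * 2) * 2 ^ M + i)                     ≡⟨ periodDoubling-prefixAtOddMultiple M q i
                                                                      (<-trans i<n (≤-<-trans n≤M (n<2^n M))) ⟩
    setHead (isOdd M) periodDoubling i                           ∎
  where open ≡-Reasoning

toFin2 : Bool → Fin 2
toFin2 false = Fin.zero
toFin2 true  = Fin.suc Fin.zero

counterexample : Word2 (Fin 2)
counterexample i j = toFin2 (setHead (isOdd j) periodDoubling i)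

counterexample-rows : (j : ℕ) → UniformlyRecurrent (row counterexample j)
counterexample-rows j =
  uniformlyRecurrent-map toFin2 (syndetic⇒uniformlyRecurrent (setHead-periodDoubling-syndetic (isOdd j)))

counterexample-columns : (i : ℕ) → UniformlyRecurrent (column counterexample i)
counterexample-columns zero    = uniformlyRecurrent-map toFin2 isOdd-uniformlyRecurrent
counterexample-columns (suc i) = constant-uniformlyRecurrent (toFin2 (periodDoubling (suc i)))

counterexample-¬URD : ¬ URD counterexample
counterexample-¬URD urd with proj₂ (urd 1 2 1 0 (1-coprimeTo 0)) 1
... | suc ℓ , _ , _ , block = toFin2-false≢true (begin
  toFin2 false                      ≡⟨ horizontalBlock {ℓ = suc ℓ} block z<s z<s ⟨
  counterexample (suc ℓ + 0) 0      ≡⟨⟩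
  counterexample (suc ℓ + 0) 1      ≡⟨ horizontalBlock {ℓ = suc ℓ} block z<s (s<s z<s) ⟩
  toFin2 true                       ∎)
  where
  open ≡-Reasoning
  toFin2-false≢true : toFin2 false ≢ toFin2 true
  toFin2-false≢true ()

proposition3p4 :
    ((k : ℕ) → (w : Word2 (Fin k)) → URD w →
        ((j : ℕ) → UniformlyRecurrent (row w j)) × ((i : ℕ) → UniformlyRecurrent (column w i)))
    × (∃[ k ] ∃[ w ] (((j : ℕ) → UniformlyRecurrent (row {Fin k} w j))
                     × ((i : ℕ) → UniformlyRecurrent (column w i))
                     × ¬ URD w))
proposition3p4 =
  (λ k w urd → URD⇒rows-uniformlyRecurrent urd , URD⇒columns-uniformlyRecurrent urd) ,
  (2 , counterexample , counterexample-rows , counterexample-columns , counterexample-¬URD)
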